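{- Let $S$ be a subset of a finite abelian group $G$. Then $S$ is an even set in $G$ if and only if for each $y\in\{SS^{(-1)}\}$ the weight enumerator $\nu_S$ is constant on $\mathrm{orb}(y)$. Equivalently, $S$ is an even set in $G$ if and only if the multiset $[SS^{(-1)}]$ is a union of orbits in $G$.
   Context: Subsets are identified with elements of the group ring $\mathbb{Z}[G]$; $S^{(-1)}=\sum_{s\in S}s^{ -1}$; $SS^{(-1)}=\sum_{y\in G}\nu_S(y)y$ where $\nu_S(y)=|\{(s_1,s_2)\in S\times S\mid y=s_1s_2^{ -1}\}|$; $\{SS^{(-1)}\}$ is its support and $[SS^{(-1)}]$ the corresponding multiset. For $y\in G$ of order $l$, $\mathrm{orb}(y)=\{y^i\mid i\in\mathbb{Z}_l^*\}$. $S$ is an even set if $SS^{(-1)}=\sum_{i=1}^r\lambda_iH_i$ in $\mathbb{Z}[G]$ for some subgroups $H_1,\dots,H_r$ of $G$ and nonzero integers $\lambda_i$ (each subgroup identified with the sum of its elements). -}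

module Defs where

open import Data.Nat using (ℕ; zero; suc; _<_)
open import Data.Integer using (ℤ; 0ℤ; +_; _*_) renaming (_+_ to _+ℤ_)
open import Data.Fin using (Fin; _≟_)
open import Data.Fin.Subset using (Subset; _∈_)
open import Data.Fin.Subset.Properties using (_∈?_)
open import Data.List using (List; []; _∷_; length; filter; allFin; cartesianProduct)
open import Data.Product using (_×_; _,_; Σ; ∃; proj₁; proj₂)
open import Data.Bool using (if_then_else_)
open import Data.Vec using (lookup)
open import Relation.Binary.PropositionalEquality using (_≡_; _≢_)
open import Relation.Nullary using (¬_)
open import Relation.Nullary.Decidable using (_×-dec_)
open import Algebra.Core using (Op₁; Op₂)
open import Algebra.Structures using (IsAbelianGroup)

-- A finite abelian group: WLOG its carrier is Fin n (every finite group is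
-- isomorphic to one of these) and its equality is propositional equality.
record FinAbGroup : Set where
  field
    n     : ℕ
    _∙_   : Op₂ (Fin n)
    ε     : Fin n
    _⁻¹   : Op₁ (Fin n)
    isAbelianGroup : IsAbelianGroup _≡_ _∙_ ε _⁻¹

module _ (G : FinAbGroup) where
  open FinAbGroup G

  pow : Fin n → ℕ → Fin n
  pow y zero    = ε
  pow y (suc i) = y ∙ pow y i

  IsOrder : Fin n → ℕ → Set
  IsOrder y l = (0 < l) × (pow y l ≡ ε) × (∀ k → 0 < k → k < l → pow y k ≢ ε)

  ν : Subset n → Fin n → ℕ
  ν S y = length (filter (λ p → (proj₁ p ∈? S) ×-dec ((proj₂ p ∈? S) ×-dec (y ≟ (proj₁ p ∙ (proj₂ p ⁻¹)))))
                         (cartesianProduct (allFin n) (allFin n)))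

  record Subgroup : Set where
    field
      carrier : Subset n
      ε∈      : ε ∈ carrier
      ∙-closed : ∀ {a b} → a ∈ carrier → b ∈ carrier → (a ∙ b) ∈ carrier
      ⁻¹-closed : ∀ {a} → a ∈ carrier → (a ⁻¹) ∈ carrier

  -- coefficient at y of  Σ_i λ_i H_i  in ℤ[G]
  combCoeff : List (Subgroup × ℤ) → Fin n → ℤ
  combCoeff [] y = 0ℤ
  combCoeff ((H , λ′) ∷ rest) y =
    (if lookup (Subgroup.carrier H) y then λ′ else 0ℤ) +ℤ combCoeff rest y

  -- S is even: SS^(-1) = Σ_{i=1}^r λ_i H_i in ℤ[G], λ_i nonzero integers
  IsEvenSet : Subset n → Set
  IsEvenSet S = Σ (List (Subgroup × ℤ)) λ Hs →
    (AllNonzero Hs) × (∀ y → + (ν S y) ≡ combCoeff Hs y)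
    where
      AllNonzero : List (Subgroup × ℤ) → Set
      AllNonzero [] = Data.Unit.⊤ where import Data.Unit
      AllNonzero ((_ , λ′) ∷ rest) = (λ′ ≢ 0ℤ) × AllNonzero rest

module Submission where

-- Orbit-invariance of ν_S needs checking only on its support: if ν_S(y) = 0 ≠ ν_S(y^i), then y is in
-- turn a coprime power of y^i. The indicator of a subgroup H is orbit-invariant (y^i ∈ H iff y ∈ H,
-- as y is a power of y^i), hence so is every ℤ-combination of subgroups. Conversely, an
-- orbit-invariant g : G → ℤ is peeled off from the top order downwards: for z of maximal order with
-- g(z) ≠ 0 subtract g(z)·⟨z⟩. This kills g on the generators of ⟨z⟩, which are the orbit of z,
-- changes g only at elements of smaller order otherwise, and keeps g orbit-invariant.

open import Defs
open import Data.Nat using (ℕ; _<_)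
open import Data.Nat.Coprimality using (Coprime)
open import Data.Fin using (Fin)
open import Data.Fin.Subset using (Subset)
open import Relation.Binary.PropositionalEquality using (_≡_; _≢_)
open import Function.Bundles using (_⇔_)

open import Algebra.Bundles using (AbelianGroup)
open import Data.Bool using (true; false; if_then_else_)
import Data.Bool.Properties as Bool
open import Data.Empty using (⊥-elim)
open import Data.Fin using (toℕ; fromℕ<; _≟_)
import Data.Fin.Properties as Fin
open import Data.Fin.Subset using (_∈_)
open import Data.Integer using (ℤ; 0ℤ; +_) renaming (_+_ to _+ℤ_; _-_ to _-ℤ_)
import Data.Integer.Properties as ℤ
open import Data.List using (List; []; _∷_; allFin)
open import Data.List.Membership.Propositional using () renaming (_∉_ to _∉ₗ_)
open import Data.List.Membership.Propositional.Properties using (∈-allFin)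
open import Data.List.Relation.Unary.Any using (toSum)
open import Data.Nat
  using (zero; suc; _+_; _*_; _∸_; _/_; _%_; _≤_; pred; s≤s; z≤n; NonZero; >-nonZero; >-nonZero⁻¹)
open import Data.Nat.Coprimality using (coprime-Bézout)
open import Data.Nat.DivMod using (m≡m%n+[m/n]*n; m%n<n)
open import Data.Nat.Divisibility using (divides)
open import Data.Nat.GCD using (module Bézout)
import Data.Nat.Properties as ℕ
open import Data.Nat.Tactic.RingSolver using (solve-∀)
open import Data.Product using (∃; Σ; _×_; _,_; proj₁; proj₂)
open import Data.Sum using ([_,_]′)
open import Data.Vec using (lookup; tabulate)
import Data.Vec.Properties as Vec
open import Function.Base using (_∘_)
open import Function.Bundles using (mk⇔; Equivalence)
import Function.Properties.Equivalence as ⇔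
open import Level using (0ℓ)
open import Relation.Binary.PropositionalEquality
  using (refl; sym; trans; cong; cong₂; subst; module ≡-Reasoning)
open import Relation.Nullary using (Dec; yes; no; does; proof)
open import Relation.Nullary.Decidable using (dec-true; decidable-stable; ¬?)
open import Relation.Nullary.Reflects using (Reflects; invert)

open import Algebra.Properties.Group (AbelianGroup.group ℤ.+-0-abelianGroup)
  using (//-rightDividesˡ)

module _ (G : FinAbGroup) where
  open FinAbGroup G

  abelianGroup : AbelianGroup 0ℓ 0ℓ
  abelianGroup = record { isAbelianGroup = isAbelianGroup }

  open AbelianGroup abelianGroup
    using (assoc; comm; identityˡ; identityʳ; group; commutativeSemigroup)
  open import Algebra.Properties.Group group using (∙-cancelˡ; identityʳ-unique; inverseʳ-unique)
  open import Algebra.Properties.CommutativeSemigroup commutativeSemigroup using (interchange)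

  infixl 30 _^_
  _^_ : Fin n → ℕ → Fin n
  _^_ = pow G

  ^-+ : ∀ z a b → z ^ (a + b) ≡ z ^ a ∙ z ^ b
  ^-+ z zero    b = sym (identityˡ (z ^ b))
  ^-+ z (suc a) b = trans (cong (z ∙_) (^-+ z a b)) (sym (assoc z (z ^ a) (z ^ b)))

  ^-* : ∀ z a b → z ^ a ^ b ≡ z ^ (b * a)
  ^-* z a zero    = refl
  ^-* z a (suc b) = trans (cong (z ^ a ∙_) (^-* z a b)) (sym (^-+ z a (b * a)))

  ^-comm : ∀ z a b → z ^ a ^ b ≡ z ^ b ^ a
  ^-comm z a b = trans (^-* z a b) (trans (cong (z ^_) (ℕ.*-comm b a)) (sym (^-* z b a)))

  ε^ : ∀ k → ε ^ k ≡ ε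
  ε^ zero    = refl
  ε^ (suc k) = trans (cong (ε ∙_) (ε^ k)) (identityˡ ε)

  ∙-^ : ∀ x y k → (x ∙ y) ^ k ≡ x ^ k ∙ y ^ k
  ∙-^ x y zero    = sym (identityˡ ε)
  ∙-^ x y (suc k) = trans (cong ((x ∙ y) ∙_) (∙-^ x y k)) (interchange x y (x ^ k) (y ^ k))

  ^-*-ε : ∀ {z l} → z ^ l ≡ ε → ∀ q → z ^ (q * l) ≡ ε
  ^-*-ε {z} {l} zˡ≡ε q = trans (sym (^-* z l q)) (trans (cong (_^ q) zˡ≡ε) (ε^ q))

  ^-^-ε : ∀ {z l} → z ^ l ≡ ε → ∀ j → z ^ j ^ l ≡ ε
  ^-^-ε {z} {l} zˡ≡ε j = trans (^-comm z j l) (trans (cong (_^ j) zˡ≡ε) (ε^ j))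

  ^-pred-⁻¹ : ∀ {z l} .{{_ : NonZero l}} → z ^ l ≡ ε → z ^ pred l ≡ z ⁻¹
  ^-pred-⁻¹ {z} {suc l} zˡ≡ε = inverseʳ-unique z (z ^ l) zˡ≡ε

  ^-% : ∀ {z l} .{{_ : NonZero l}} → z ^ l ≡ ε → ∀ m → z ^ m ≡ z ^ (m % l)
  ^-% {z} {l} zˡ≡ε m = begin
    z ^ m                          ≡⟨ cong (z ^_) (m≡m%n+[m/n]*n m l) ⟩
    z ^ (m % l + m / l * l)        ≡⟨ ^-+ z (m % l) (m / l * l) ⟩
    z ^ (m % l) ∙ z ^ (m / l * l)  ≡⟨ cong (z ^ (m % l) ∙_) (^-*-ε zˡ≡ε (m / l)) ⟩
    z ^ (m % l) ∙ ε                ≡⟨ identityʳ (z ^ (m % l)) ⟩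
    z ^ (m % l)                    ∎
    where open ≡-Reasoning

  ^-cancel-ε : ∀ z {i j} → i ≤ j → z ^ i ≡ z ^ j → z ^ (j ∸ i) ≡ ε
  ^-cancel-ε z {i} {j} i≤j zⁱ≡zʲ = identityʳ-unique (z ^ i) (z ^ (j ∸ i)) (begin
    z ^ i ∙ z ^ (j ∸ i)   ≡⟨ ^-+ z i (j ∸ i) ⟨
    z ^ (i + (j ∸ i))     ≡⟨ cong (z ^_) (ℕ.m+[n∸m]≡n i≤j) ⟩
    z ^ j                 ≡⟨ zⁱ≡zʲ ⟨
    z ^ i                 ∎)
    where open ≡-Reasoning

  order-minimal : ∀ {z l k} → IsOrder G z l → 0 < k → z ^ k ≡ ε → l ≤ k
  order-minimal (_ , _ , below) 0<k zᵏ≡ε = ℕ.≮⇒≥ (λ k<l → below _ 0<k k<l zᵏ≡ε)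

  positive-power-ε : ∀ z → ∃ λ (k : Fin n) → z ^ suc (toℕ k) ≡ ε
  positive-power-ε z
    with i , j , i<j , zⁱ≡zʲ ← Fin.pigeonhole (ℕ.n<1+n n) (λ (m : Fin (suc n)) → z ^ toℕ m) =
    fromℕ< d-1<n , subst (λ m → z ^ m ≡ ε) d≡suc[k] (^-cancel-ε z (ℕ.<⇒≤ i<j) zⁱ≡zʲ)
    where
    d = toℕ j ∸ toℕ i
    instance
      d≢0 : NonZero d
      d≢0 = >-nonZero (ℕ.m<n⇒0<n∸m i<j)
    d-1<n : pred d < n
    d-1<n = subst (_≤ n) (sym (ℕ.suc-pred d)) (ℕ.≤-trans (ℕ.m∸n≤m (toℕ j) (toℕ i)) (Fin.toℕ≤pred[n] j))
    d≡suc[k] : d ≡ suc (toℕ (fromℕ< d-1<n))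
    d≡suc[k] = trans (sym (ℕ.suc-pred d)) (cong suc (sym (Fin.toℕ-fromℕ< d-1<n)))

  order-exists : ∀ z → ∃ λ l → l ≤ n × IsOrder G z l
  order-exists z
    with k , ¬zᵏ⁺¹≢ε , below ← Fin.¬∀⟶∃¬-smallest n (λ k → z ^ suc (toℕ k) ≢ ε)
                                  (λ k → ¬? (z ^ suc (toℕ k) ≟ ε))
                                  (λ none → let k , zᵏ⁺¹≡ε = positive-power-ε z in none k zᵏ⁺¹≡ε) =
    suc (toℕ k) , Fin.toℕ<n k , s≤s z≤n , decidable-stable (_ ≟ ε) ¬zᵏ⁺¹≢ε , minimal
    where
    minimal : ∀ m → 0 < m → m < suc (toℕ k) → z ^ m ≢ ε
    minimal (suc m) _ (s≤s m<k) =
      subst (λ t → z ^ suc t ≢ ε) (trans (Fin.toℕ-inject (fromℕ< m<k)) (Fin.toℕ-fromℕ< m<k))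
        (below (fromℕ< m<k))

  -- Opaque so that unification does not unfold the order search, which is very costly.
  opaque
    ord : Fin n → ℕ
    ord z = proj₁ (order-exists z)

    ord≤n : ∀ z → ord z ≤ n
    ord≤n z = proj₁ (proj₂ (order-exists z))

    ord-isOrder : ∀ z → IsOrder G z (ord z)
    ord-isOrder z = proj₂ (proj₂ (order-exists z))

  ord-positive : ∀ z → 0 < ord z
  ord-positive z = proj₁ (ord-isOrder z)

  ^-ord : ∀ z → z ^ ord z ≡ ε
  ^-ord z = proj₁ (proj₂ (ord-isOrder z))

  instance
    ord-nonZero : ∀ {z} → NonZero (ord z)
    ord-nonZero {z} = >-nonZero (ord-positive z)

  coprime-exponent-invertible : ∀ {z l i} → IsOrder G z l → Coprime i l → ∃ λ e → z ^ i ^ e ≡ z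
  coprime-exponent-invertible {z} {l} {i} (_ , zˡ≡ε , _) i⊥l with coprime-Bézout i⊥l
  ... | Bézout.+- x y 1+yl≡xi = x , (begin
    z ^ i ^ x            ≡⟨ ^-* z i x ⟩
    z ^ (x * i)          ≡⟨ cong (z ^_) 1+yl≡xi ⟨
    z ∙ z ^ (y * l)      ≡⟨ cong (z ∙_) (^-*-ε zˡ≡ε y) ⟩
    z ∙ ε                ≡⟨ identityʳ z ⟩
    z                    ∎)
    where open ≡-Reasoning
  ... | Bézout.-+ x y 1+xi≡yl = x * i * x , (begin
    z ^ i ^ (x * i * x)  ≡⟨ ^-* (z ^ i) x (x * i) ⟨
    z ^ i ^ x ^ (x * i)  ≡⟨ cong (_^ (x * i)) (^-* z i x) ⟩
    a ^ (x * i)          ≡⟨ ∙-cancelˡ a _ _ a∙aˣⁱ≡a∙z ⟩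
    z                    ∎)
    where
    open ≡-Reasoning
    -- Here a = z ^ (x * i) is the inverse of z, so a ^ (x * i) is the inverse of a, i.e. z.
    a = z ^ (x * i)
    z∙a≡ε : z ∙ a ≡ ε
    z∙a≡ε = trans (cong (z ^_) 1+xi≡yl) (^-*-ε zˡ≡ε y)
    a∙aˣⁱ≡a∙z : a ∙ a ^ (x * i) ≡ a ∙ z
    a∙aˣⁱ≡a∙z = begin
      a ∙ a ^ (x * i)      ≡⟨ ∙-^ z a (x * i) ⟨
      (z ∙ a) ^ (x * i)    ≡⟨ cong (_^ (x * i)) z∙a≡ε ⟩
      ε ^ (x * i)          ≡⟨ ε^ (x * i) ⟩
      ε                    ≡⟨ trans (comm a z) z∙a≡ε ⟨
      a ∙ z                ∎

  isOrder-^-coprime : ∀ {z l i} → IsOrder G z l → Coprime i l → IsOrder G (z ^ i) l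
  isOrder-^-coprime {z} {l} {i} o@(0<l , zˡ≡ε , below) i⊥l = 0<l , ^-^-ε {z} {l} zˡ≡ε i , below′
    where
    e = proj₁ (coprime-exponent-invertible o i⊥l)
    below′ : ∀ k → 0 < k → k < l → z ^ i ^ k ≢ ε
    below′ k 0<k k<l zⁱᵏ≡ε = below k 0<k k<l (begin
      z ^ k                ≡⟨ cong (_^ k) (proj₂ (coprime-exponent-invertible o i⊥l)) ⟨
      z ^ i ^ e ^ k        ≡⟨ ^-comm (z ^ i) e k ⟩
      z ^ i ^ k ^ e        ≡⟨ cong (_^ e) zⁱᵏ≡ε ⟩
      ε ^ e                ≡⟨ ε^ e ⟩
      ε                    ∎)
      where open ≡-Reasoning

  -- A common divisor d of j and l = b * d makes (z ^ j) ^ b trivial, so l ≤ b forces d = 1.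
  isOrder-^⇒coprime : ∀ {z l j} → IsOrder G z l → IsOrder G (z ^ j) l → Coprime j l
  isOrder-^⇒coprime {z} (0<bd , zᵇᵈ≡ε , _) oʲ {d} (divides a refl , divides b refl) =
    ℕ.≤-antisym (ℕ.*-cancelˡ-≤ b bd≤b*1) (>-nonZero⁻¹ d)
    where
    instance
      bd≢0 : NonZero (b * d)
      bd≢0 = >-nonZero 0<bd
      b≢0 : NonZero b
      b≢0 = ℕ.m*n≢0⇒m≢0 b
      d≢0 : NonZero d
      d≢0 = ℕ.m*n≢0⇒n≢0 b
    reorder : ∀ a b d → b * (a * d) ≡ a * (b * d)
    reorder = solve-∀
    zᵃᵈᵇ≡ε : z ^ (a * d) ^ b ≡ ε
    zᵃᵈᵇ≡ε = trans (^-* z (a * d) b) (trans (cong (z ^_) (reorder a b d)) (^-*-ε zᵇᵈ≡ε a))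
    bd≤b*1 : b * d ≤ b * 1
    bd≤b*1 = subst (b * d ≤_) (sym (ℕ.*-identityʳ b)) (order-minimal oʲ (>-nonZero⁻¹ b) zᵃᵈᵇ≡ε)

  OrbitInvariant : {A : Set} → (Fin n → A) → Set
  OrbitInvariant f = ∀ z l → IsOrder G z l → ∀ i → i < l → Coprime i l → f (z ^ i) ≡ f z

  OrbitInvariantOnSupport : (Fin n → ℕ) → Set
  OrbitInvariantOnSupport f =
    ∀ y → f y ≢ 0 → ∀ l → IsOrder G y l → ∀ i → i < l → Coprime i l → f (y ^ i) ≡ f y

  orbitInvariant⇔onSupport : (f : Fin n → ℕ) → OrbitInvariant f ⇔ OrbitInvariantOnSupport f
  orbitInvariant⇔onSupport f = mk⇔ (λ f-inv y _ → f-inv y) fromSupport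
    where
    fromSupport : OrbitInvariantOnSupport f → OrbitInvariant f
    fromSupport inv z l o i i<l i⊥l with f z ℕ.≟ 0 | f (z ^ i) ℕ.≟ 0
    ... | no fz≢0  | _         = inv z fz≢0 l o i i<l i⊥l
    ... | yes fz≡0 | yes fzⁱ≡0 = trans fzⁱ≡0 (sym fz≡0)
    ... | yes _    | no fzⁱ≢0  =
      sym (trans (cong f (sym zⁱᵉ≡z)) (inv (z ^ i) fzⁱ≢0 l oⁱ (e % l) (m%n<n e l) e⊥l))
      where
      instance
        l≢0 : NonZero l
        l≢0 = >-nonZero (proj₁ o)
      oⁱ = isOrder-^-coprime o i⊥l
      e = proj₁ (coprime-exponent-invertible o i⊥l)
      zⁱᵉ≡z : z ^ i ^ (e % l) ≡ z
      zⁱᵉ≡z = trans (sym (^-% (proj₁ (proj₂ oⁱ)) e)) (proj₂ (coprime-exponent-invertible o i⊥l))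
      e⊥l : Coprime (e % l) l
      e⊥l = isOrder-^⇒coprime oⁱ (subst (λ w → IsOrder G w l) (sym zⁱᵉ≡z) o)

  +-orbitInvariant⇔ : ∀ {f : Fin n → ℕ} → OrbitInvariant (+_ ∘ f) ⇔ OrbitInvariant f
  +-orbitInvariant⇔ = mk⇔
    (λ +f-inv z l o i i<l i⊥l → ℤ.+-injective (+f-inv z l o i i<l i⊥l))
    (λ f-inv z l o i i<l i⊥l → cong +_ (f-inv z l o i i<l i⊥l))

  ^-closed : (H : Subgroup G) → ∀ {z} → z ∈ Subgroup.carrier H → ∀ k → z ^ k ∈ Subgroup.carrier H
  ^-closed H z∈H zero    = Subgroup.ε∈ H
  ^-closed H z∈H (suc k) = Subgroup.∙-closed H z∈H (^-closed H z∈H k)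

  lookup-orbitInvariant : (H : Subgroup G) → OrbitInvariant (lookup (Subgroup.carrier H))
  lookup-orbitInvariant H z l o i _ i⊥l = Bool.⇔→≡ (mk⇔ fromPower toPower)
    where
    C = Subgroup.carrier H
    e = proj₁ (coprime-exponent-invertible o i⊥l)
    fromPower : lookup C (z ^ i) ≡ true → lookup C z ≡ true
    fromPower zⁱ∈H = subst (λ w → lookup C w ≡ true) (proj₂ (coprime-exponent-invertible o i⊥l))
      (Vec.[]=⇒lookup (^-closed H (Vec.lookup⇒[]= (z ^ i) C zⁱ∈H) e))
    toPower : lookup C z ≡ true → lookup C (z ^ i) ≡ true
    toPower z∈H = Vec.[]=⇒lookup (^-closed H (Vec.lookup⇒[]= z C z∈H) i)

  combCoeff-orbitInvariant : ∀ Hs → OrbitInvariant (combCoeff G Hs)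
  combCoeff-orbitInvariant []              z l o i i<l i⊥l = refl
  combCoeff-orbitInvariant ((H , c) ∷ Hs) z l o i i<l i⊥l =
    cong₂ _+ℤ_ (cong (if_then c else 0ℤ) (lookup-orbitInvariant H z l o i i<l i⊥l))
               (combCoeff-orbitInvariant Hs z l o i i<l i⊥l)

  IsPowerOf : Fin n → Fin n → Set
  IsPowerOf z w = ∃ λ (j : Fin (ord z)) → z ^ toℕ j ≡ w

  isPowerOf? : ∀ z w → Dec (IsPowerOf z w)
  isPowerOf? z w = Fin.any? (λ j → z ^ toℕ j ≟ w)

  cyclicCarrier : Fin n → Subset n
  cyclicCarrier z = tabulate (λ w → does (isPowerOf? z w))

  lookup-cyclicCarrier : ∀ z w → lookup (cyclicCarrier z) w ≡ true ⇔ IsPowerOf z w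
  lookup-cyclicCarrier z w = mk⇔
    (λ w∈ → invert (subst (Reflects _) (trans (sym (Vec.lookup∘tabulate _ w)) w∈)
                          (proof (isPowerOf? z w))))
    (λ w∈ → trans (Vec.lookup∘tabulate _ w) (dec-true (isPowerOf? z w) w∈))

  ^-∈-cyclicCarrier : ∀ z m → lookup (cyclicCarrier z) (z ^ m) ≡ true
  ^-∈-cyclicCarrier z m = Equivalence.from (lookup-cyclicCarrier z (z ^ m))
    (fromℕ< m%l<l , trans (cong (z ^_) (Fin.toℕ-fromℕ< m%l<l)) (sym (^-% (^-ord z) m)))
    where
    m%l<l = m%n<n m (ord z)

  ∈-cyclicCarrier : ∀ z → lookup (cyclicCarrier z) z ≡ true
  ∈-cyclicCarrier z =
    subst (λ w → lookup (cyclicCarrier z) w ≡ true) (identityʳ z) (^-∈-cyclicCarrier z 1)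

  ⟨_⟩ : Fin n → Subgroup G
  ⟨ z ⟩ = record
    { carrier   = cyclicCarrier z
    ; ε∈        = ^-∈ 0
    ; ∙-closed  = λ a∈ b∈ → ∙-closed (exponent a∈) (exponent b∈)
    ; ⁻¹-closed = λ a∈ → ⁻¹-closed (exponent a∈)
    }
    where
    ^-∈ : ∀ m → z ^ m ∈ cyclicCarrier z
    ^-∈ m = Vec.lookup⇒[]= (z ^ m) (cyclicCarrier z) (^-∈-cyclicCarrier z m)
    exponent : ∀ {a} → a ∈ cyclicCarrier z → IsPowerOf z a
    exponent {a} a∈ = Equivalence.to (lookup-cyclicCarrier z a) (Vec.[]=⇒lookup a∈)
    ∙-closed : ∀ {a b} → IsPowerOf z a → IsPowerOf z b → a ∙ b ∈ cyclicCarrier z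
    ∙-closed (j , refl) (k , refl) =
      subst (_∈ cyclicCarrier z) (^-+ z (toℕ j) (toℕ k)) (^-∈ (toℕ j + toℕ k))
    ⁻¹-closed : ∀ {a} → IsPowerOf z a → a ⁻¹ ∈ cyclicCarrier z
    ⁻¹-closed (j , refl) = subst (_∈ cyclicCarrier z)
      (trans (sym (^-* z (toℕ j) (pred (ord z)))) (^-pred-⁻¹ {z ^ toℕ j} {ord z} aˡ≡ε))
      (^-∈ (pred (ord z) * toℕ j))
      where
      aˡ≡ε : z ^ toℕ j ^ ord z ≡ ε
      aˡ≡ε = ^-^-ε {z} {ord z} (^-ord z) (toℕ j)

  ∈-cyclicCarrier⇒ord-≤ : ∀ z w → lookup (cyclicCarrier z) w ≡ true → ord w ≤ ord z
  ∈-cyclicCarrier⇒ord-≤ z w w∈ with (j , refl) ← Equivalence.to (lookup-cyclicCarrier z w) w∈ =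
    order-minimal (ord-isOrder (z ^ toℕ j)) (ord-positive z) (^-^-ε {z} {ord z} (^-ord z) (toℕ j))

  SubgroupCombination : (List (Subgroup G × ℤ) → Set) → (Fin n → ℤ) → Set
  SubgroupCombination P g = Σ (List (Subgroup G × ℤ)) λ Hs → P Hs × (∀ y → g y ≡ combCoeff G Hs y)

  combination⇒orbitInvariant : ∀ {P g} → SubgroupCombination P g → OrbitInvariant g
  combination⇒orbitInvariant (Hs , _ , g≡) z l o i i<l i⊥l =
    trans (g≡ (z ^ i)) (trans (combCoeff-orbitInvariant Hs z l o i i<l i⊥l) (sym (g≡ z)))

  subtractCyclic : (Fin n → ℤ) → Fin n → Fin n → ℤ
  subtractCyclic g z y = g y -ℤ (if lookup (cyclicCarrier z) y then g z else 0ℤ)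

  subtractCyclic-orbitInvariant : ∀ {g} z → OrbitInvariant g → OrbitInvariant (subtractCyclic g z)
  subtractCyclic-orbitInvariant {g} z g-inv w l o i i<l i⊥l =
    cong₂ _-ℤ_ (g-inv w l o i i<l i⊥l)
               (cong (if_then g z else 0ℤ) (lookup-orbitInvariant ⟨ z ⟩ w l o i i<l i⊥l))

  subtractCyclic-outside : ∀ {g} z {w} → lookup (cyclicCarrier z) w ≡ false → subtractCyclic g z w ≡ g w
  subtractCyclic-outside {g} z {w} w∉ rewrite w∉ = ℤ.+-identityʳ (g w)

  subtractCyclic-generator : ∀ {g} z {w} → OrbitInvariant g →
    lookup (cyclicCarrier z) w ≡ true → ord w ≡ ord z → subtractCyclic g z w ≡ 0ℤ
  subtractCyclic-generator {g} z {w} g-inv w∈ ordw≡ordz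
    with (j , refl) ← Equivalence.to (lookup-cyclicCarrier z w) w∈ rewrite w∈ =
    ℤ.i≡j⇒i-j≡0 (g-inv z (ord z) (ord-isOrder z) (toℕ j) (Fin.toℕ<n j)
                         (isOrder-^⇒coprime (ord-isOrder z) oʲ))
    where
    oʲ : IsOrder G (z ^ toℕ j) (ord z)
    oʲ = subst (IsOrder G (z ^ toℕ j)) ordw≡ordz (ord-isOrder (z ^ toℕ j))

  VanishesAbove : ℕ → (Fin n → ℤ) → Set
  VanishesAbove k g = ∀ y → k < ord y → g y ≡ 0ℤ

  VanishesBeyond : ℕ → List (Fin n) → (Fin n → ℤ) → Set
  VanishesBeyond k L g = VanishesAbove k g × (∀ w → ord w ≡ k → w ∉ₗ L → g w ≡ 0ℤ)

  vanishesBeyond-allFin : ∀ {k g} → VanishesAbove k g → VanishesBeyond k (allFin n) g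
  vanishesBeyond-allFin g≡0 = g≡0 , λ w _ w∉ → ⊥-elim (w∉ (∈-allFin w))

  vanishesBeyond-[] : ∀ {k g} → VanishesBeyond (suc k) [] g → VanishesAbove k g
  vanishesBeyond-[] (g≡0 , g≡0′) y k<ordy =
    [ g≡0 y , (λ k+1≡ordy → g≡0′ y (sym k+1≡ordy) λ ()) ]′ (ℕ.m≤n⇒m<n∨m≡n k<ordy)

  vanishesBeyond-∷-zero : ∀ {k z L g} → g z ≡ 0ℤ → VanishesBeyond k (z ∷ L) g → VanishesBeyond k L g
  vanishesBeyond-∷-zero {z = z} {g = g} gz≡0 (g≡0 , g≡0′) = g≡0 , cleared
    where
    cleared : ∀ w → ord w ≡ _ → w ∉ₗ _ → g w ≡ 0ℤ
    cleared w ordw w∉L with w ≟ z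
    ... | yes refl = gz≡0
    ... | no  w≢z  = g≡0′ w ordw ([ w≢z , w∉L ]′ ∘ toSum)

  vanishesBeyond-∷-subtractCyclic : ∀ {k z L g} → OrbitInvariant g → g z ≢ 0ℤ →
    VanishesBeyond k (z ∷ L) g → VanishesBeyond k L (subtractCyclic g z)
  vanishesBeyond-∷-subtractCyclic {k} {z} {L} {g} g-inv gz≢0 (g≡0 , g≡0′) = above , cleared
    where
    ordz≤k : ord z ≤ k
    ordz≤k = ℕ.≮⇒≥ (λ k<ordz → gz≢0 (g≡0 z k<ordz))
    above : VanishesAbove k (subtractCyclic g z)
    above y k<ordy with lookup (cyclicCarrier z) y in y∈
    ... | true  = ⊥-elim (ℕ.<⇒≱ k<ordy (ℕ.≤-trans (∈-cyclicCarrier⇒ord-≤ z y y∈) ordz≤k))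
    ... | false = trans (ℤ.+-identityʳ (g y)) (g≡0 y k<ordy)
    cleared : ∀ w → ord w ≡ k → w ∉ₗ L → subtractCyclic g z w ≡ 0ℤ
    cleared w ordw w∉L with lookup (cyclicCarrier z) w Bool.≟ true
    ... | yes w∈ = subtractCyclic-generator z g-inv w∈
                     (ℕ.≤-antisym (∈-cyclicCarrier⇒ord-≤ z w w∈) (subst (ord z ≤_) (sym ordw) ordz≤k))
    ... | no  w∉ = trans (subtractCyclic-outside {g} z {w} (Bool.¬-not w∉))
                         (g≡0′ w ordw ([ w≢z , w∉L ]′ ∘ toSum))
      where
      w≢z : w ≢ z
      w≢z refl = w∉ (∈-cyclicCarrier z)

  -- P is left abstract because the nonzero-coefficient predicate of IsEvenSet is local to its
  -- where-clause; it is recovered by unification in proposition4p5.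
  module _ {P : List (Subgroup G × ℤ) → Set}
           (P-[] : P []) (P-∷ : ∀ {H c Hs} → c ≢ 0ℤ → P Hs → P ((H , c) ∷ Hs)) where

    combination-subtractCyclic : ∀ {g} z → g z ≢ 0ℤ →
      SubgroupCombination P (subtractCyclic g z) → SubgroupCombination P g
    combination-subtractCyclic {g} z gz≢0 (Hs , P-Hs , g′≡) = (⟨ z ⟩ , g z) ∷ Hs , P-∷ gz≢0 P-Hs ,
      λ y → let c = if lookup (cyclicCarrier z) y then g z else 0ℤ in
        trans (sym (//-rightDividesˡ c (g y)))
              (trans (cong (_+ℤ c) (g′≡ y)) (ℤ.+-comm (combCoeff G Hs y) c))

    combination-clearing : ∀ {k} →
      (∀ g → OrbitInvariant g → VanishesBeyond k [] g → SubgroupCombination P g) →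
      ∀ L g → OrbitInvariant g → VanishesBeyond k L g → SubgroupCombination P g
    combination-clearing done [] g g-inv g≡0 = done g g-inv g≡0
    combination-clearing done (z ∷ L) g g-inv g≡0 with g z ℤ.≟ 0ℤ
    ... | yes gz≡0 = combination-clearing done L g g-inv (vanishesBeyond-∷-zero gz≡0 g≡0)
    ... | no  gz≢0 = combination-subtractCyclic z gz≢0
      (combination-clearing done L (subtractCyclic g z) (subtractCyclic-orbitInvariant z g-inv)
        (vanishesBeyond-∷-subtractCyclic g-inv gz≢0 g≡0))

    combination-vanishingAbove : ∀ k g → OrbitInvariant g → VanishesAbove k g → SubgroupCombination P g
    combination-vanishingAbove zero    g _     g≡0 = [] , P-[] , λ y → g≡0 y (ord-positive y)
    combination-vanishingAbove (suc k) g g-inv g≡0 =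
      combination-clearing (λ g′ g′-inv → combination-vanishingAbove k g′ g′-inv ∘ vanishesBeyond-[])
        (allFin n) g g-inv (vanishesBeyond-allFin g≡0)

    combination⇔orbitInvariant : ∀ g → SubgroupCombination P g ⇔ OrbitInvariant g
    combination⇔orbitInvariant g = mk⇔ combination⇒orbitInvariant λ g-inv →
      combination-vanishingAbove n g g-inv λ y n<ordy → ⊥-elim (ℕ.<⇒≱ n<ordy (ord≤n y))

proposition4p5 : (G : FinAbGroup) (S : Subset (FinAbGroup.n G)) →
    IsEvenSet G S ⇔
    (∀ (y : Fin (FinAbGroup.n G)) → ν G S y ≢ 0 →
    ∀ (l : ℕ) → IsOrder G y l →
    ∀ (i : ℕ) → i < l → Coprime i l → ν G S (pow G y i) ≡ ν G S y)
proposition4p5 G S =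
  ⇔.trans (combination⇔orbitInvariant G _ _,_ (+_ ∘ ν G S))
    (⇔.trans (+-orbitInvariant⇔ G) (orbitInvariant⇔onSupport G (ν G S)))
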